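{- Let $G$ be a finite simple $r$-regular graph with $r$ even ($r \geq 2$). Then for all integers $p \geq 0$ and $q \geq 2$, \[ \alpha_p(G) \leq \alpha_q(L(G)). \]
   Context: For a graph $G$ and a non-negative integer $p$, a set $S \subseteq V(G)$ is $p$-independent if the subgraph induced by $S$ has maximum degree at most $p$; $\alpha_p(G)$ denotes the maximum cardinality of a $p$-independent set of $G$. $L(G)$ is the line graph of $G$. -}

module Defs where

open import Data.Nat using (ℕ; zero; suc; _≤_; _<_)
open import Data.Bool using (Bool; true; false; T; not; _∧_; _∨_)
open import Data.Fin using (Fin; toℕ)
import Data.Fin as Fin
open import Data.List using (List; []; _∷_; map; length)
open import Data.List.Membership.Propositional using (_∈_)
open import Data.List.Relation.Unary.Unique.Propositional using (Unique)
open import Data.Product using (Σ; _×_; _,_; proj₁; proj₂)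
open import Relation.Binary.PropositionalEquality using (_≡_; refl; cong; cong₂)
import Relation.Binary.PropositionalEquality as Eq
open import Relation.Nullary using (yes; no)
open import Data.Empty using (⊥-elim)
open import Data.Bool.Properties using (∧-comm; ∨-comm; ∨-assoc)
open import Relation.Nullary.Decidable using (⌊_⌋)

record Graph (V : Set) : Set where
  field
    Adj    : V → V → Bool
    sym    : ∀ u v → Adj u v ≡ Adj v u
    irrefl : ∀ v → Adj v v ≡ false
open Graph public

countTrue : List Bool → ℕ
countTrue []           = 0
countTrue (true  ∷ bs) = suc (countTrue bs)
countTrue (false ∷ bs) = countTrue bs

-- A finite vertex subset is a duplicate-free list; its cardinality is its length.
-- Degree of v inside the subgraph induced by S.
degIn : {V : Set} → Graph V → List V → V → ℕ
degIn G S v = countTrue (map (Adj G v) S)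

IsPIndependent : {V : Set} → Graph V → ℕ → List V → Set
IsPIndependent G p S = Unique S × (∀ v → v ∈ S → degIn G S v ≤ p)

-- α_p(G) ≤ α_q(H): every p-independent set of G is at most as large as
-- some q-independent set of H (both graphs are finite, so maxima exist).
AlphaLe : {V W : Set} → Graph V → ℕ → Graph W → ℕ → Set
AlphaLe {V} {W} G p H q =
  ∀ (S : List V) → IsPIndependent G p S →
    Σ (List W) λ T → IsPIndependent H q T × length S ≤ length T

degree : {n : ℕ} → Graph (Fin n) → Fin n → ℕ
degree {n} G v = countTrue (map (Adj G v) (Data.List.allFin n))

Regular : {n : ℕ} → Graph (Fin n) → ℕ → Set
Regular G r = ∀ v → degree G v ≡ r

Edge : {n : ℕ} → Graph (Fin n) → Set
Edge {n} G = Σ (Fin n × Fin n) λ e → (toℕ (proj₁ e) < toℕ (proj₂ e)) × T (Adj G (proj₁ e) (proj₂ e))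

eqF : {n : ℕ} → Fin n → Fin n → Bool
eqF a b = ⌊ a Fin.≟ b ⌋

lineAdj : {n : ℕ} (G : Graph (Fin n)) → Edge G → Edge G → Bool
lineAdj G ((a , b) , _) ((c , d) , _) =
  not (eqF a c ∧ eqF b d) ∧ (eqF a c ∨ eqF a d ∨ eqF b c ∨ eqF b d)

eqF-sym : {n : ℕ} (a b : Fin n) → eqF a b ≡ eqF b a
eqF-sym a b with a Fin.≟ b | b Fin.≟ a
... | yes _ | yes _ = refl
... | no _  | no _  = refl
... | yes p | no q  = ⊥-elim (q (Eq.sym p))
... | no p  | yes q = ⊥-elim (p (Eq.sym q))

eqF-refl : {n : ℕ} (a : Fin n) → eqF a a ≡ true
eqF-refl a with a Fin.≟ a
... | yes _ = refl
... | no q  = ⊥-elim (q refl)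

lineAdj-sym : {n : ℕ} (G : Graph (Fin n)) (e f : Edge G) → lineAdj G e f ≡ lineAdj G f e
lineAdj-sym G ((a , b) , _) ((c , d) , _)
  rewrite eqF-sym a c | eqF-sym b d | eqF-sym a d | eqF-sym b c
  with eqF c a | eqF d b | eqF d a | eqF c b
... | x | y | z | w = cong (λ t → not (x ∧ y) ∧ (x ∨ t))
        (Eq.trans (Eq.sym (∨-assoc z w y))
        (Eq.trans (cong (_∨ y) (∨-comm z w)) (∨-assoc w z y)))

lineAdj-irrefl : {n : ℕ} (G : Graph (Fin n)) (e : Edge G) → lineAdj G e e ≡ false
lineAdj-irrefl G ((a , b) , _) rewrite eqF-refl a | eqF-refl b = refl

LineGraph : {n : ℕ} (G : Graph (Fin n)) → Graph (Edge G)
LineGraph G = record { Adj = lineAdj G ; sym = lineAdj-sym G ; irrefl = lineAdj-irrefl G }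

-- A 2k-regular graph G (k ≥ 1) has a 2-factor (Petersen). Orient the edges so that every vertex
-- has in- and out-degree k, by repeatedly splitting off pairs of edges at a vertex; then Hall's
-- theorem gives a perfect matching x ↦ σ x in the k-regular bipartite graph of arcs, so σ is a
-- permutation with x σx an edge and σ (σ x) ≠ x, each edge being oriented only one way. The n
-- edges {x, σ x} are distinct and each meets only the two edges {σ⁻¹ x, x} and {σ x, σ² x}: they
-- form a 2-independent, hence q-independent, set of n vertices of L(G), while a p-independent set
-- of G has at most n vertices.
module Submission where

open import Defs hiding (sym; irrefl)
open import Data.Bool using (Bool; true; false; T; not; _∧_; _∨_)
open import Data.Bool.Properties using (T-∧; T-∨; ∧-zeroʳ; ∧-identityʳ)
open import Data.Empty using (⊥; ⊥-elim)
open import Data.Fin using (Fin; zero; suc; toℕ; _≟_)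
open import Data.Fin.Properties using (any?)
import Data.Fin.Properties as Finₚ
open import Data.Fin.Subset.Properties using (anySubset?)
open import Data.List using (List; _∷_; map; allFin; tabulate; length; lookup)
open import Data.List.Properties using (map-tabulate; map-∘; length-map; length-tabulate)
open import Data.List.Membership.Propositional.Properties using (∈-lookup; ∈-map⁻)
import Data.List.Relation.Unary.All as ListAll
open import Data.List.Relation.Unary.AllPairs using (_∷_)
open import Data.List.Relation.Unary.Unique.Propositional using (Unique)
import Data.List.Relation.Unary.Unique.Propositional.Properties as Uniqueₚ
open import Data.Nat
  using (ℕ; zero; suc; _+_; _*_; _∸_; _≤_; _<_; _<ᵇ_; z≤n; s≤s; z<s; _<?_; NonZero)
open import Data.Nat.Divisibility using (_∣_; divides; ∣m+n∣m⇒∣n; ∣1⇒≡1)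
open import Data.Nat.Induction using (<-wellFounded)
open import Data.Nat.Properties hiding (_≟_)
open import Algebra.Properties.CommutativeSemigroup +-commutativeSemigroup
  using (interchange; xy∙z≈xz∙y)
open import Algebra.Properties.Semiring.Sum +-*-semiring
  using (sum; sum-syntax; sum-cong-≗; ∑-distrib-+; ∑-comm; *-distribˡ-sum; *-distribʳ-sum)
open import Data.Nat.Tactic.RingSolver using (solve-∀)
open import Data.Product using (Σ; ∃; _×_; _,_; proj₁; proj₂)
import Data.Product as Product
open import Data.Sum using (_⊎_; inj₁; inj₂)
import Data.Sum as Sum
import Data.Vec as Vec
open import Data.Vec.Properties using (lookup∘tabulate)
open import Function using (_∘_; Injective; Equivalence; _⇔_; mk⇔; case_of_)
open import Induction.WellFounded using (module All)
import Relation.Binary.Construct.On as On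
open import Relation.Binary.Definitions using (tri<; tri≈; tri>)
open import Relation.Binary.PropositionalEquality
  using (_≡_; _≢_; refl; sym; trans; cong; cong₂; subst; subst₂; module ≡-Reasoning)
open import Relation.Nullary using (¬_; yes; no; Dec; contradiction; ¬?; _×-dec_)
open import Relation.Nullary.Decidable using (⌊_⌋; T?; toWitness; fromWitness)

open Equivalence using (to; from)

[_] : Bool → ℕ
[ true ]  = 1
[ false ] = 0

[]≤1 : ∀ b → [ b ] ≤ 1
[]≤1 true  = ≤-refl
[]≤1 false = z≤n

[]-mono : ∀ {a b} → (T a → T b) → [ a ] ≤ [ b ]
[]-mono {false}         _   = z≤n
[]-mono {true}  {true}  _   = ≤-refl
[]-mono {true}  {false} a⇒b = ⊥-elim (a⇒b _)

T⇒[]≡1 : ∀ {b} → T b → [ b ] ≡ 1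
T⇒[]≡1 {true} _ = refl

¬T⇒[]≡0 : ∀ {b} → ¬ T b → [ b ] ≡ 0
¬T⇒[]≡0 {false} _  = refl
¬T⇒[]≡0 {true}  ¬b = contradiction _ ¬b

0<[]⇒T : ∀ {b} → 0 < [ b ] → T b
0<[]⇒T {true} _ = _

[]≤[]+[] : ∀ {a b c} → (T a → T b ⊎ T c) → [ a ] ≤ [ b ] + [ c ]
[]≤[]+[] {false}         _     = z≤n
[]≤[]+[] {true} {b} {c} a⇒b∨c with a⇒b∨c _
... | inj₁ Tb = ≤-trans (≤-reflexive (sym (T⇒[]≡1 Tb))) (m≤m+n [ b ] [ c ])
... | inj₂ Tc = ≤-trans (≤-reflexive (sym (T⇒[]≡1 Tc))) (m≤n+m [ c ] [ b ])

[]*≤ : ∀ a k → [ a ] * k ≤ k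
[]*≤ true  k = ≤-reflexive (+-identityʳ k)
[]*≤ false k = z≤n

[0<ᵇn]≡n : ∀ n → n ≤ 1 → [ 0 <ᵇ n ] ≡ n
[0<ᵇn]≡n zero          _        = refl
[0<ᵇn]≡n (suc zero)    _        = refl
[0<ᵇn]≡n (suc (suc n)) (s≤s ())

¬T⇒T-not : ∀ {b} → ¬ T b → T (not b)
¬T⇒T-not {false} _  = _
¬T⇒T-not {true}  ¬b = ¬b _

T-not⇒¬T : ∀ {b} → T (not b) → ¬ T b
T-not⇒¬T {false} _ ()

eqF⇒≡ : ∀ {n} {a b : Fin n} → T (eqF a b) → a ≡ b
eqF⇒≡ = toWitness

≡⇒eqF : ∀ {n} {a b : Fin n} → a ≡ b → T (eqF a b)
≡⇒eqF = fromWitness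

≢⇒eqF≡false : ∀ {n} {a b : Fin n} → a ≢ b → eqF a b ≡ false
≢⇒eqF≡false {a = a} {b} a≢b with a ≟ b
... | yes a≡b = contradiction a≡b a≢b
... | no  _   = refl

countTrue-map-allFin : ∀ n (f : Fin n → Bool) → countTrue (map f (allFin n)) ≡ ∑[ i < n ] [ f i ]
countTrue-map-allFin n f = trans (cong countTrue (map-tabulate (λ i → i) f)) (countTrue-tabulate n f)
  where
  countTrue-tabulate : ∀ n (f : Fin n → Bool) → countTrue (tabulate f) ≡ ∑[ i < n ] [ f i ]
  countTrue-tabulate zero    f = refl
  countTrue-tabulate (suc n) f with f zero
  ... | true  = cong suc (countTrue-tabulate n (f ∘ suc))
  ... | false = countTrue-tabulate n (f ∘ suc)

∑-mono-≤ : ∀ {n} {f g : Fin n → ℕ} → (∀ i → f i ≤ g i) → ∑[ i < n ] f i ≤ ∑[ i < n ] g i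
∑-mono-≤ {zero}  f≤g = z≤n
∑-mono-≤ {suc n} f≤g = +-mono-≤ (f≤g zero) (∑-mono-≤ (f≤g ∘ suc))

∑-mono-< : ∀ {n} {f g : Fin n → ℕ} → (∀ i → f i ≤ g i) → ∀ j → f j < g j →
           ∑[ i < n ] f i < ∑[ i < n ] g i
∑-mono-< f≤g zero    fj<gj = +-mono-<-≤ fj<gj (∑-mono-≤ (f≤g ∘ suc))
∑-mono-< f≤g (suc j) fj<gj = +-mono-≤-< (f≤g zero) (∑-mono-< (f≤g ∘ suc) j fj<gj)

∑-pos : ∀ {n} (f : Fin n → ℕ) → 0 < ∑[ i < n ] f i → ∃ λ i → 0 < f i
∑-pos {suc n} f 0<∑ with f zero in eq
... | suc _ = zero , subst (0 <_) (sym eq) z<s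
... | zero  = let (i , 0<fi) = ∑-pos (f ∘ suc) 0<∑ in suc i , 0<fi

∑-zero : ∀ {n} {f : Fin n → ℕ} → (∀ i → f i ≡ 0) → ∑[ i < n ] f i ≡ 0
∑-zero {zero}  f≡0 = refl
∑-zero {suc n} f≡0 = cong₂ _+_ (f≡0 zero) (∑-zero (f≡0 ∘ suc))

∑-δ : ∀ {n} (x : Fin n) → ∑[ i < n ] [ eqF i x ] ≡ 1
∑-δ {suc n} zero    = cong suc (∑-zero {n} {λ i → [ eqF (suc i) zero ]} λ _ → refl)
∑-δ {suc n} (suc x) = trans (sum-cong-≗ λ i → cong [_] (eqF-suc i)) (∑-δ x)
  where
  eqF-suc : ∀ i → eqF (suc i) (suc x) ≡ eqF i x
  eqF-suc i with i ≟ x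
  ... | yes _ = refl
  ... | no  _ = refl

∑-atMostOne : ∀ {n} (f : Fin n → Bool) → (∀ {i j} → T (f i) → T (f j) → i ≡ j) →
              ∑[ i < n ] [ f i ] ≤ 1
∑-atMostOne {zero}  f unique = z≤n
∑-atMostOne {suc n} f unique with T? (f zero)
... | yes f₀ = ≤-reflexive (cong₂ _+_ (T⇒[]≡1 f₀)
                 (∑-zero {n} {λ i → [ f (suc i) ]} λ i → ¬T⇒[]≡0 λ fᵢ → Finₚ.0≢1+n (unique f₀ fᵢ)))
... | no ¬f₀ = subst (_≤ 1) (cong (_+ ∑[ i < n ] [ f (suc i) ]) (sym (¬T⇒[]≡0 ¬f₀)))
                 (∑-atMostOne (f ∘ suc) λ fᵢ fⱼ → Finₚ.suc-injective (unique fᵢ fⱼ))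

m+m≡n+n⇒m≡n : ∀ m n → m + m ≡ n + n → m ≡ n
m+m≡n+n⇒m≡n zero    zero    _  = refl
m+m≡n+n⇒m≡n (suc m) (suc n) eq rewrite +-suc m m | +-suc n n =
  cong suc (m+m≡n+n⇒m≡n m n (suc-injective (suc-injective eq)))

2∣n+n : ∀ n → 2 ∣ n + n
2∣n+n n = divides n (trans (cong (n +_) (sym (+-identityʳ n))) (*-comm 2 n))

2∣-cancel : ∀ {m m′} k → m ≡ m′ + (k + k) → 2 ∣ m → 2 ∣ m′
2∣-cancel {m′ = m′} k m≡ 2∣m = ∣m+n∣m⇒∣n (subst (2 ∣_) (trans m≡ (+-comm m′ (k + k))) 2∣m) (2∣n+n k)

lookup-injective : ∀ {A : Set} {xs : List A} → Unique xs → Injective _≡_ _≡_ (lookup xs)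
lookup-injective (_  ∷ _) {zero}  {zero}  _  = refl
lookup-injective (x∉ ∷ _) {zero}  {suc j} eq = contradiction eq (ListAll.lookup x∉ (∈-lookup j))
lookup-injective (x∉ ∷ _) {suc i} {zero}  eq = contradiction (sym eq) (ListAll.lookup x∉ (∈-lookup i))
lookup-injective (_  ∷ u) {suc i} {suc j} eq = cong suc (lookup-injective u eq)

Unique⇒length≤ : ∀ {n} (S : List (Fin n)) → Unique S → length S ≤ n
Unique⇒length≤ S unique = Finₚ.injective⇒≤ (lookup-injective unique)

-- Hall's theorem

-- Subsets of Fin k are Boolean predicates, and a bipartite graph between Fin m and Fin n is a
-- Boolean matrix.
∣_∣ : ∀ {k} → (Fin k → Bool) → ℕ
∣_∣ {k} X = ∑[ i < k ] [ X i ]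

⁅_⁆ : ∀ {k} → Fin k → Fin k → Bool
⁅ x ⁆ i = eqF i x

_∪_ _∩_ : ∀ {k} → (Fin k → Bool) → (Fin k → Bool) → Fin k → Bool
(X ∪ Y) i = X i ∨ Y i
(X ∩ Y) i = X i ∧ Y i

_─_ : ∀ {k} → (Fin k → Bool) → Fin k → Fin k → Bool
(X ─ x) i = X i ∧ not (eqF i x)

∈─ : ∀ {k} {X : Fin k → Bool} {x i} → T ((X ─ x) i) → T (X i) × i ≢ x
∈─ Xi─x = let (Xi , i≠x) = to T-∧ Xi─x in Xi , λ i≡x → T-not⇒¬T i≠x (≡⇒eqF i≡x)

∣∣-mono : ∀ {k} {X Y : Fin k → Bool} → (∀ i → T (X i) → T (Y i)) → ∣ X ∣ ≤ ∣ Y ∣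
∣∣-mono X⊆Y = ∑-mono-≤ λ i → []-mono (X⊆Y i)

∣∣-pos : ∀ {k} (X : Fin k → Bool) → 0 < ∣ X ∣ → ∃ λ i → T (X i)
∣∣-pos X 0<∣X∣ = let (i , 0<Xi) = ∑-pos _ 0<∣X∣ in i , 0<[]⇒T 0<Xi

∣∪∣+∣∩∣ : ∀ {k} (X Y : Fin k → Bool) → ∣ X ∪ Y ∣ + ∣ X ∩ Y ∣ ≡ ∣ X ∣ + ∣ Y ∣
∣∪∣+∣∩∣ {k} X Y =
  trans (sym (∑-distrib-+ {k} _ _)) (trans (sum-cong-≗ pointwise) (∑-distrib-+ {k} _ _))
  where
  pointwise : ∀ i → [ X i ∨ Y i ] + [ X i ∧ Y i ] ≡ [ X i ] + [ Y i ]
  pointwise i with X i | Y i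
  ... | true  | true  = refl
  ... | true  | false = refl
  ... | false | true  = refl
  ... | false | false = refl

∣∣≡1+∣─∣ : ∀ {k} (X : Fin k → Bool) {x} → T (X x) → ∣ X ∣ ≡ suc ∣ X ─ x ∣
∣∣≡1+∣─∣ {k} X {x} Xx = begin
  ∣ X ∣                         ≡⟨ sum-cong-≗ pointwise ⟩
  ∑[ i < k ] ([ (X ─ x) i ] + [ eqF i x ]) ≡⟨ ∑-distrib-+ {k} _ _ ⟩
  ∣ X ─ x ∣ + ∣ ⁅ x ⁆ ∣          ≡⟨ cong (∣ X ─ x ∣ +_) (∑-δ x) ⟩
  ∣ X ─ x ∣ + 1                 ≡⟨ +-comm _ 1 ⟩
  suc ∣ X ─ x ∣                 ∎
  where
  open ≡-Reasoning
  pointwise : ∀ i → [ X i ] ≡ [ (X ─ x) i ] + [ eqF i x ]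
  pointwise i with i ≟ x
  ... | yes refl rewrite ∧-zeroʳ (X i) = T⇒[]≡1 Xx
  ... | no  _    rewrite ∧-identityʳ (X i) = sym (+-identityʳ _)

distinct⇒2≤∣∣ : ∀ {k} (X : Fin k → Bool) {x y} → x ≢ y → T (X x) → T (X y) → 2 ≤ ∣ X ∣
distinct⇒2≤∣∣ X {x} {y} x≢y Xx Xy = begin
  2               ≡⟨ cong suc (sym (∑-δ y)) ⟩
  suc ∣ ⁅ y ⁆ ∣    ≤⟨ s≤s (∣∣-mono ⁅y⁆⊆X─x) ⟩
  suc ∣ X ─ x ∣    ≡⟨ sym (∣∣≡1+∣─∣ X Xx) ⟩
  ∣ X ∣            ∎
  where
  open ≤-Reasoning
  ⁅y⁆⊆X─x : ∀ i → T (eqF i y) → T ((X ─ x) i)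
  ⁅y⁆⊆X─x i i=y with refl ← eqF⇒≡ i=y = from T-∧ (Xy , ¬T⇒T-not λ y=x → x≢y (sym (eqF⇒≡ y=x)))

module _ {m n : ℕ} where

  N : (Fin m → Fin n → Bool) → (Fin m → Bool) → Fin n → Bool
  N B X c = ⌊ any? (λ y → T? (X y ∧ B y c)) ⌋

  N-intro : ∀ B X {y c} → T (X y) → T (B y c) → T (N B X c)
  N-intro B X Xy Byc = fromWitness (_ , from T-∧ (Xy , Byc))

  N-elim : ∀ B X {c} → T (N B X c) → ∃ λ y → T (X y) × T (B y c)
  N-elim B X NXc = let (y , XyByc) = toWitness NXc in y , to (T-∧ {X y}) XyByc

  HallCondition : (Fin m → Fin n → Bool) → Set
  HallCondition B = ∀ X → ∣ X ∣ ≤ ∣ N B X ∣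

  Matching : (Fin m → Fin n → Bool) → Set
  Matching B = Σ (Fin m → Fin n) λ σ → Injective _≡_ _≡_ σ × (∀ x → T (B x (σ x)))

  hallCondition? : ∀ B → HallCondition B ⊎ ∃ λ X → ∣ N B X ∣ < ∣ X ∣
  hallCondition? B with anySubset? (λ V → ∣ N B (Vec.lookup V) ∣ <? ∣ Vec.lookup V ∣)
  ... | yes (V , violated) = inj₂ (Vec.lookup V , violated)
  ... | no  ¬violated      = inj₁ λ X → ≮⇒≥ λ violated → ¬violated (Vec.tabulate X , onVector X violated)
    where
    onVector : ∀ X → ∣ N B X ∣ < ∣ X ∣ →
               ∣ N B (Vec.lookup (Vec.tabulate X)) ∣ < ∣ Vec.lookup (Vec.tabulate X) ∣
    onVector X violated = begin-strict
      ∣ N B (Vec.lookup (Vec.tabulate X)) ∣ ≤⟨ ∣∣-mono N-mono ⟩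
      ∣ N B X ∣                     <⟨ violated ⟩
      ∣ X ∣                         ≡⟨ sum-cong-≗ (λ i → cong [_] (lookup∘tabulate X i)) ⟨
      ∣ Vec.lookup (Vec.tabulate X) ∣       ∎
      where
      open ≤-Reasoning
      N-mono : ∀ c → T (N B (Vec.lookup (Vec.tabulate X)) c) → T (N B X c)
      N-mono c NXc with y , Xy , Byc ← N-elim B _ NXc = N-intro B X (subst T (lookup∘tabulate X y) Xy) Byc

  _∖_ : (Fin m → Fin n → Bool) → Fin m × Fin n → Fin m → Fin n → Bool
  (B ∖ (x , c)) y d = B y d ∧ not (eqF y x ∧ eqF d c)

  ∖-⊆ : ∀ B e y d → T ((B ∖ e) y d) → T (B y d)
  ∖-⊆ B e y d = proj₁ ∘ to (T-∧ {B y d})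

  ∖-keeps : ∀ B {x c y d} → T (B y d) → ¬ (y ≡ x × d ≡ c) → T ((B ∖ (x , c)) y d)
  ∖-keeps B {x} {c} {y} {d} Byd ≢xc = from (T-∧ {B y d}) (Byd , ¬T⇒T-not λ yd=xc →
    let (y=x , d=c) = to (T-∧ {eqF y x}) yd=xc in ≢xc (eqF⇒≡ y=x , eqF⇒≡ d=c))

  ∖-removes : ∀ B x c → ¬ T ((B ∖ (x , c)) x c)
  ∖-removes B x c Bxc∖ =
    T-not⇒¬T (proj₂ (to (T-∧ {B x c}) Bxc∖)) (from (T-∧ {eqF x x}) (≡⇒eqF refl , ≡⇒eqF refl))

  edges : (Fin m → Fin n → Bool) → ℕ
  edges B = ∑[ y < m ] ∑[ d < n ] [ B y d ]

  ∖-edges< : ∀ {B x c} → T (B x c) → edges (B ∖ (x , c)) < edges B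
  ∖-edges< {B} {x} {c} Bxc =
    ∑-mono-< {m} (λ y → ∑-mono-≤ {n} λ d → []-mono (∖-⊆ B (x , c) y d)) x
      (∑-mono-< {n} (λ d → []-mono (∖-⊆ B (x , c) x d)) c
        (subst₂ _<_ (sym (¬T⇒[]≡0 (∖-removes B x c))) (sym (T⇒[]≡1 Bxc)) z<s))

  ∖-violator-∋ : ∀ {B x c X} → HallCondition B → ∣ N (B ∖ (x , c)) X ∣ < ∣ X ∣ → T (X x)
  ∖-violator-∋ {B} {x} {c} {X} hall violated with T? (X x)
  ... | yes Xx = Xx
  ... | no ¬Xx = contradiction (≤-<-trans (≤-trans (hall X) (∣∣-mono N⊆N∖)) violated) (<-irrefl refl)
    where
    N⊆N∖ : ∀ d → T (N B X d) → T (N (B ∖ (x , c)) X d)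
    N⊆N∖ d NXd with y , Xy , Byd ← N-elim B X NXd =
      N-intro (B ∖ (x , c)) X Xy (∖-keeps B Byd λ (y≡x , _) → ¬Xx (subst (T ∘ X) y≡x Xy))

  no-two-violators : ∀ {B x c₁ c₂ X₁ X₂} → HallCondition B → c₁ ≢ c₂ →
    ∣ N (B ∖ (x , c₁)) X₁ ∣ < ∣ X₁ ∣ → ∣ N (B ∖ (x , c₂)) X₂ ∣ < ∣ X₂ ∣ → ⊥
  no-two-violators {B} {x} {c₁} {c₂} {X₁} {X₂} hall c₁≢c₂ violated₁ violated₂ =
    <-irrefl refl (begin-strict
      ∣ X₁ ∣ + ∣ X₂ ∣                      ≡⟨ ∣∪∣+∣∩∣ X₁ X₂ ⟨
      ∣ X₁ ∪ X₂ ∣ + ∣ X₁ ∩ X₂ ∣            ≡⟨ cong (∣ X₁ ∪ X₂ ∣ +_) (∣∣≡1+∣─∣ (X₁ ∩ X₂) x∈X₁∩X₂) ⟩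
      ∣ X₁ ∪ X₂ ∣ + suc ∣ I ∣              ≡⟨ +-suc _ _ ⟩
      suc (∣ X₁ ∪ X₂ ∣ + ∣ I ∣)            ≤⟨ s≤s (+-mono-≤ (hall _) (hall _)) ⟩
      suc (∣ N B (X₁ ∪ X₂) ∣ + ∣ N B I ∣)  ≤⟨ s≤s (+-mono-≤ (∣∣-mono N∪) (∣∣-mono N∩)) ⟩
      suc (∣ A₁ ∪ A₂ ∣ + ∣ A₁ ∩ A₂ ∣)      ≡⟨ cong suc (∣∪∣+∣∩∣ A₁ A₂) ⟩
      suc (∣ A₁ ∣ + ∣ A₂ ∣)                <⟨ s≤s (≤-reflexive (sym (+-suc _ _))) ⟩
      suc ∣ A₁ ∣ + suc ∣ A₂ ∣              ≤⟨ +-mono-≤ violated₁ violated₂ ⟩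
      ∣ X₁ ∣ + ∣ X₂ ∣                      ∎)
    where
    open ≤-Reasoning
    I : Fin m → Bool
    I = (X₁ ∩ X₂) ─ x
    A₁ A₂ : Fin n → Bool
    A₁ = N (B ∖ (x , c₁)) X₁
    A₂ = N (B ∖ (x , c₂)) X₂
    x∈X₁ : T (X₁ x)
    x∈X₁ = ∖-violator-∋ hall violated₁
    x∈X₂ : T (X₂ x)
    x∈X₂ = ∖-violator-∋ hall violated₂
    x∈X₁∩X₂ : T ((X₁ ∩ X₂) x)
    x∈X₁∩X₂ = from (T-∧ {X₁ x}) (x∈X₁ , x∈X₂)
    N∪ : ∀ d → T (N B (X₁ ∪ X₂) d) → T ((A₁ ∪ A₂) d)
    N∪ d N∪d with y , y∈X₁∪X₂ , Byd ← N-elim B (X₁ ∪ X₂) N∪d | y ≟ x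
    ... | no y≢x = from (T-∨ {A₁ d}) (Sum.map
            (λ y∈X₁ → N-intro (B ∖ (x , c₁)) X₁ y∈X₁ (∖-keeps B Byd (y≢x ∘ proj₁)))
            (λ y∈X₂ → N-intro (B ∖ (x , c₂)) X₂ y∈X₂ (∖-keeps B Byd (y≢x ∘ proj₁)))
            (to (T-∨ {X₁ y}) y∈X₁∪X₂))
    ... | yes refl = from (T-∨ {A₁ d}) (atX (d ≟ c₁))
      where
      atX : Dec (d ≡ c₁) → T (A₁ d) ⊎ T (A₂ d)
      atX (no d≢c₁)  = inj₁ (N-intro (B ∖ (x , c₁)) X₁ x∈X₁ (∖-keeps B Byd (d≢c₁ ∘ proj₂)))
      atX (yes refl) = inj₂ (N-intro (B ∖ (x , c₂)) X₂ x∈X₂ (∖-keeps B Byd (c₁≢c₂ ∘ proj₂)))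
    N∩ : ∀ d → T (N B I d) → T ((A₁ ∩ A₂) d)
    N∩ d N∩d with y , y∈I , Byd ← N-elim B I N∩d =
      let (y∈X₁∩X₂ , y≢x) = ∈─ {X = X₁ ∩ X₂} y∈I
          (y∈X₁ , y∈X₂)   = to (T-∧ {X₁ y}) y∈X₁∩X₂
      in from (T-∧ {A₁ d}) ( N-intro (B ∖ (x , c₁)) X₁ y∈X₁ (∖-keeps B Byd (y≢x ∘ proj₁))
                           , N-intro (B ∖ (x , c₂)) X₂ y∈X₂ (∖-keeps B Byd (y≢x ∘ proj₁)))

  functional-matching : ∀ {B} → HallCondition B →
    (∀ {x c d} → T (B x c) → T (B x d) → c ≡ d) → Matching B
  functional-matching {B} hall functional = σ , σ-injective , σ-adjacent
    where
    neighbour : ∀ x → ∃ λ c → T (B x c)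
    neighbour x
      with c , N⁅x⁆c ← ∣∣-pos (N B ⁅ x ⁆) (≤-trans (≤-reflexive (sym (∑-δ x))) (hall ⁅ x ⁆))
      with y , y=x , Byc ← N-elim B ⁅ x ⁆ N⁅x⁆c
      with refl ← eqF⇒≡ y=x
      = c , Byc
    σ : Fin m → Fin n
    σ x = proj₁ (neighbour x)
    σ-adjacent : ∀ x → T (B x (σ x))
    σ-adjacent x = proj₂ (neighbour x)
    σ-injective : Injective _≡_ _≡_ σ
    σ-injective {x} {y} σx≡σy with x ≟ y
    ... | yes x≡y = x≡y
    ... | no  x≢y = contradiction
        (≤-trans (distinct⇒2≤∣∣ pair x≢y x∈pair y∈pair) (≤-trans (hall pair) N-atMostOne)) λ { (s≤s ()) }
      where
      pair : Fin m → Bool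
      pair = ⁅ x ⁆ ∪ ⁅ y ⁆
      x∈pair : T (pair x)
      x∈pair = from (T-∨ {eqF x x}) (inj₁ (≡⇒eqF refl))
      y∈pair : T (pair y)
      y∈pair = from (T-∨ {eqF y x}) (inj₂ (≡⇒eqF refl))
      only-σx : ∀ {c} → T (N B pair c) → c ≡ σ x
      only-σx Nc with z , z∈pair , Bzc ← N-elim B pair Nc with to (T-∨ {eqF z x}) z∈pair
      ... | inj₁ z=x with refl ← eqF⇒≡ z=x = functional Bzc (σ-adjacent z)
      ... | inj₂ z=y with refl ← eqF⇒≡ z=y = trans (functional Bzc (σ-adjacent z)) (sym σx≡σy)
      N-atMostOne : ∣ N B pair ∣ ≤ 1
      N-atMostOne = ∑-atMostOne (N B pair) λ Nc Nd → trans (only-σx Nc) (sym (only-σx Nd))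

  ∖-matching : ∀ B e → Matching (B ∖ e) → Matching B
  ∖-matching B e (σ , σ-injective , σ-adjacent) = σ , σ-injective , λ x → ∖-⊆ B e x (σ x) (σ-adjacent x)

  -- Rado's proof, by induction on the number of edges: if some x has two neighbours c₁ ≠ c₂,
  -- deleting one of the edges x c₁, x c₂ preserves Hall's condition (`no-two-violators`);
  -- otherwise Hall's condition for singletons and pairs makes x ↦ its neighbour a matching.
  hall : ∀ B → HallCondition B → Matching B
  hall = All.wfRec (On.wellFounded edges <-wellFounded) _ (λ B → HallCondition B → Matching B) step
    where
    step : ∀ B → (∀ {B′} → edges B′ < edges B → HallCondition B′ → Matching B′) →
           HallCondition B → Matching B
    step B rec hallB
      with any? (λ x → any? λ c₁ → any? λ c₂ → ¬? (c₁ ≟ c₂) ×-dec T? (B x c₁) ×-dec T? (B x c₂))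
    ... | no ¬branching = functional-matching hallB functional
      where
      functional : ∀ {x c d} → T (B x c) → T (B x d) → c ≡ d
      functional {x} {c} {d} Bxc Bxd with c ≟ d
      ... | yes c≡d = c≡d
      ... | no  c≢d = contradiction (x , c , d , c≢d , Bxc , Bxd) ¬branching
    ... | yes (x , c₁ , c₂ , c₁≢c₂ , Bxc₁ , Bxc₂)
      with hallCondition? (B ∖ (x , c₁)) | hallCondition? (B ∖ (x , c₂))
    ... | inj₁ hall₁        | _                = ∖-matching B (x , c₁) (rec (∖-edges< Bxc₁) hall₁)
    ... | inj₂ _            | inj₁ hall₂       = ∖-matching B (x , c₂) (rec (∖-edges< Bxc₂) hall₂)
    ... | inj₂ (_ , viol₁)  | inj₂ (_ , viol₂) = ⊥-elim (no-two-violators hallB c₁≢c₂ viol₁ viol₂)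

  biregular-hallCondition : ∀ {B} k → .{{NonZero k}} →
    (∀ x → k ≤ ∑[ c < n ] [ B x c ]) → (∀ c → ∑[ x < m ] [ B x c ] ≤ k) → HallCondition B
  biregular-hallCondition {B} k rows columns X = *-cancelʳ-≤ ∣ X ∣ ∣ N B X ∣ k (begin
    ∣ X ∣ * k                                    ≡⟨ *-distribʳ-sum k (λ x → [ X x ]) ⟩
    ∑[ x < m ] ([ X x ] * k)                     ≤⟨ ∑-mono-≤ {m} (λ x → *-monoʳ-≤ [ X x ] (rows x)) ⟩
    ∑[ x < m ] ([ X x ] * ∑[ c < n ] [ B x c ])
      ≡⟨ sum-cong-≗ (λ x → *-distribˡ-sum [ X x ] (λ c → [ B x c ])) ⟩
    ∑[ x < m ] ∑[ c < n ] ([ X x ] * [ B x c ])  ≡⟨ ∑-comm (λ x c → [ X x ] * [ B x c ]) ⟩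
    ∑[ c < n ] ∑[ x < m ] ([ X x ] * [ B x c ])  ≤⟨ ∑-mono-≤ {n} column ⟩
    ∑[ c < n ] ([ N B X c ] * k)                 ≡⟨ *-distribʳ-sum k (λ c → [ N B X c ]) ⟨
    ∣ N B X ∣ * k                                ∎)
    where
    open ≤-Reasoning
    column : ∀ c → ∑[ x < m ] ([ X x ] * [ B x c ]) ≤ [ N B X c ] * k
    column c with T? (N B X c)
    ... | yes NXc rewrite T⇒[]≡1 NXc | +-identityʳ k =
      ≤-trans (∑-mono-≤ {m} λ x → []*≤ (X x) [ B x c ]) (columns c)
    ... | no ¬NXc rewrite ¬T⇒[]≡0 ¬NXc = ≤-reflexive (∑-zero {m} isolated)
      where
      isolated : ∀ x → [ X x ] * [ B x c ] ≡ 0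
      isolated x with T? (X x)
      ... | no  ¬Xx rewrite ¬T⇒[]≡0 ¬Xx = refl
      ... | yes Xx  rewrite ¬T⇒[]≡0 (¬NXc ∘ N-intro B X Xx) = *-zeroʳ [ X x ]

-- Balanced orientations of even multigraphs

-- Multigraphs and multidigraphs on Fin n are matrices of edge and arc multiplicities.
Mat : ℕ → Set
Mat n = Fin n → Fin n → ℕ

module _ {n : ℕ} where

  infixl 6 _⊕_ _⊖_
  infix 4 _≐_

  _⊕_ _⊖_ : Mat n → Mat n → Mat n
  (M ⊕ M′) a b = M a b + M′ a b
  (M ⊖ M′) a b = M a b ∸ M′ a b

  _≐_ : Mat n → Mat n → Set
  M ≐ M′ = ∀ a b → M a b ≡ M′ a b

  Symmetric Loopless : Mat n → Set
  Symmetric M = ∀ a b → M a b ≡ M b a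
  Loopless M = ∀ a → M a a ≡ 0

  deg indeg : Mat n → Fin n → ℕ
  deg M a = ∑[ b < n ] M a b
  indeg M a = ∑[ b < n ] M b a

  total : Mat n → ℕ
  total M = ∑[ a < n ] deg M a

  arc : Fin n → Fin n → Mat n
  arc x y a b = [ eqF a x ] * [ eqF b y ]

  undirected : Mat n → Mat n
  undirected O a b = O a b + O b a

  edge : Fin n → Fin n → Mat n
  edge x y = undirected (arc x y)

  Balanced : Mat n → Set
  Balanced O = ∀ a → deg O a ≡ indeg O a

  EulerianOrientation : Mat n → Set
  EulerianOrientation M = Σ (Mat n) λ O → undirected O ≐ M × Balanced O

  record EvenMultigraph (M : Mat n) : Set where
    field
      symmetric : Symmetric M
      loopless  : Loopless M
      even      : ∀ a → 2 ∣ deg M a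

  deg-cong : ∀ {M M′} → M ≐ M′ → ∀ a → deg M a ≡ deg M′ a
  deg-cong M≐M′ a = sum-cong-≗ (M≐M′ a)

  indeg-cong : ∀ {M M′} → M ≐ M′ → ∀ a → indeg M a ≡ indeg M′ a
  indeg-cong M≐M′ a = sum-cong-≗ λ b → M≐M′ b a

  total-cong : ∀ {M M′} → M ≐ M′ → total M ≡ total M′
  total-cong M≐M′ = sum-cong-≗ (deg-cong M≐M′)

  deg-⊕ : ∀ M M′ a → deg (M ⊕ M′) a ≡ deg M a + deg M′ a
  deg-⊕ M M′ a = ∑-distrib-+ (M a) (M′ a)

  indeg-⊕ : ∀ M M′ a → indeg (M ⊕ M′) a ≡ indeg M a + indeg M′ a
  indeg-⊕ M M′ a = ∑-distrib-+ (λ b → M b a) (λ b → M′ b a)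

  deg-undirected : ∀ O a → deg (undirected O) a ≡ deg O a + indeg O a
  deg-undirected O a = ∑-distrib-+ (O a) (λ b → O b a)

  deg-arc : ∀ x y a → deg (arc x y) a ≡ [ eqF a x ]
  deg-arc x y a = begin
    ∑[ b < n ] ([ eqF a x ] * [ eqF b y ]) ≡⟨ *-distribˡ-sum [ eqF a x ] (λ b → [ eqF b y ]) ⟨
    [ eqF a x ] * ∑[ b < n ] [ eqF b y ]   ≡⟨ cong ([ eqF a x ] *_) (∑-δ y) ⟩
    [ eqF a x ] * 1                        ≡⟨ *-identityʳ _ ⟩
    [ eqF a x ]                            ∎
    where open ≡-Reasoning

  indeg-arc : ∀ x y a → indeg (arc x y) a ≡ [ eqF a y ]
  indeg-arc x y a = begin
    ∑[ b < n ] ([ eqF b x ] * [ eqF a y ]) ≡⟨ *-distribʳ-sum [ eqF a y ] (λ b → [ eqF b x ]) ⟨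
    ∑[ b < n ] [ eqF b x ] * [ eqF a y ]   ≡⟨ cong (_* [ eqF a y ]) (∑-δ x) ⟩
    1 * [ eqF a y ]                        ≡⟨ *-identityˡ _ ⟩
    [ eqF a y ]                            ∎
    where open ≡-Reasoning

  deg-edge : ∀ x y a → deg (edge x y) a ≡ [ eqF a x ] + [ eqF a y ]
  deg-edge x y a = trans (deg-undirected (arc x y) a) (cong₂ _+_ (deg-arc x y a) (indeg-arc x y a))

  deg-⊕-edge : ∀ M x y a → deg (M ⊕ edge x y) a ≡ deg M a + ([ eqF a x ] + [ eqF a y ])
  deg-⊕-edge M x y a = trans (deg-⊕ M (edge x y) a) (cong (deg M a +_) (deg-edge x y a))

  total-⊕-edge : ∀ M x y → total (M ⊕ edge x y) ≡ total M + 2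
  total-⊕-edge M x y = begin
    ∑[ a < n ] deg (M ⊕ edge x y) a                             ≡⟨ sum-cong-≗ (deg-⊕-edge M x y) ⟩
    ∑[ a < n ] (deg M a + ([ eqF a x ] + [ eqF a y ]))          ≡⟨ ∑-distrib-+ (deg M) _ ⟩
    total M + ∑[ a < n ] ([ eqF a x ] + [ eqF a y ])            ≡⟨ cong (total M +_) (∑-distrib-+ {n} _ _) ⟩
    total M + (∑[ a < n ] [ eqF a x ] + ∑[ a < n ] [ eqF a y ])
      ≡⟨ cong (total M +_) (cong₂ _+_ (∑-δ x) (∑-δ y)) ⟩
    total M + 2                                                 ∎
    where open ≡-Reasoning

  arc-at : ∀ x y → arc x y x y ≡ 1
  arc-at x y rewrite eqF-refl x | eqF-refl y = refl

  arc-off : ∀ x y a b → ¬ (a ≡ x × b ≡ y) → arc x y a b ≡ 0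
  arc-off x y a b ≢xy with a ≟ x
  ... | no  _    = refl
  ... | yes refl rewrite ≢⇒eqF≡false (≢xy ∘ (refl ,_)) = refl

  arc-transpose : ∀ x y a b → arc x y b a ≡ arc y x a b
  arc-transpose x y a b = *-comm [ eqF b x ] [ eqF a y ]

  undirected-symmetric : ∀ O → Symmetric (undirected O)
  undirected-symmetric O a b = +-comm (O a b) (O b a)

  edge-comm : ∀ x y → edge x y ≐ edge y x
  edge-comm x y a b =
    trans (+-comm (arc x y a b) _) (cong₂ _+_ (arc-transpose x y a b) (sym (arc-transpose y x a b)))

  edge-loopless : ∀ {x y} → x ≢ y → Loopless (edge x y)
  edge-loopless {x} {y} x≢y a = cong₂ _+_ (arc-off x y a a ≢xy) (arc-off x y a a ≢xy)
    where
    ≢xy : ¬ (a ≡ _ × a ≡ _)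
    ≢xy (refl , refl) = x≢y refl

  arc-≤ : ∀ {O : Mat n} {x y} → 0 < O x y → ∀ a b → arc x y a b ≤ O a b
  arc-≤ {O} {x} {y} 0<Oxy a b with (a ≟ x) ×-dec (b ≟ y)
  ... | yes (refl , refl) = subst (_≤ O a b) (sym (arc-at a b)) 0<Oxy
  ... | no  ≢xy           = subst (_≤ O a b) (sym (arc-off x y a b ≢xy)) z≤n

  edge-at : ∀ x y → x ≢ y → edge x y x y ≡ 1
  edge-at x y x≢y = cong₂ _+_ (arc-at x y) (arc-off x y y x (x≢y ∘ proj₂))

  edge-off : ∀ x y a b → ¬ (a ≡ x × b ≡ y) → ¬ (a ≡ y × b ≡ x) → edge x y a b ≡ 0
  edge-off x y a b ≢xy ≢yx = cong₂ _+_ (arc-off x y a b ≢xy) (arc-off x y b a (≢yx ∘ Product.swap))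

  edge-≤ : ∀ {M x y} → Symmetric M → x ≢ y → 0 < M x y → ∀ a b → edge x y a b ≤ M a b
  edge-≤ {M} {x} {y} symmetric x≢y 0<Mxy a b with (a ≟ x) ×-dec (b ≟ y) | (a ≟ y) ×-dec (b ≟ x)
  ... | yes (refl , refl) | _ = subst (_≤ M a b) (sym (edge-at x y x≢y)) 0<Mxy
  ... | no  _ | yes (refl , refl) =
    subst₂ _≤_ (sym (trans (edge-comm x y a b) (edge-at y x (x≢y ∘ sym)))) (symmetric b a) 0<Mxy
  ... | no ≢xy | no ≢yx = subst (_≤ M a b) (sym (edge-off x y a b ≢xy ≢yx)) z≤n

  ⊖-split : ∀ {M M′} → (∀ a b → M′ a b ≤ M a b) → M ≐ (M ⊖ M′) ⊕ M′
  ⊖-split M′≤M a b = sym (m∸n+n≡m (M′≤M a b))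

  ⊖-symmetric : ∀ {M M′} → Symmetric M → Symmetric M′ → Symmetric (M ⊖ M′)
  ⊖-symmetric symM symM′ a b = cong₂ _∸_ (symM a b) (symM′ a b)

  ⊖-loopless : ∀ M M′ → Loopless M → Loopless (M ⊖ M′)
  ⊖-loopless M M′ looplessM a rewrite looplessM a = 0∸n≡0 (M′ a a)

  loopless-≢ : ∀ {M x y} → Loopless M → 0 < M x y → x ≢ y
  loopless-≢ {M} looplessM 0<Mxy refl = <-irrefl (sym (looplessM _)) 0<Mxy

  deg-⊕-arc : ∀ O x y a → deg (O ⊕ arc x y) a ≡ deg O a + [ eqF a x ]
  deg-⊕-arc O x y a = trans (deg-⊕ O (arc x y) a) (cong (deg O a +_) (deg-arc x y a))

  indeg-⊕-arc : ∀ O x y a → indeg (O ⊕ arc x y) a ≡ indeg O a + [ eqF a y ]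
  indeg-⊕-arc O x y a = trans (indeg-⊕ O (arc x y) a) (cong (indeg O a +_) (indeg-arc x y a))

  undirected-⊕-arc : ∀ O x y → undirected (O ⊕ arc x y) ≐ undirected O ⊕ edge x y
  undirected-⊕-arc O x y a b = interchange (O a b) (arc x y a b) (O b a) (arc x y b a)

  balanced-⊕-2cycle : ∀ {O} x y → Balanced O → Balanced (O ⊕ arc x y ⊕ arc y x)
  balanced-⊕-2cycle {O} x y balanced a = begin
    deg (O ⊕ arc x y ⊕ arc y x) a         ≡⟨ deg-⊕-arc (O ⊕ arc x y) y x a ⟩
    deg (O ⊕ arc x y) a + [ eqF a y ]     ≡⟨ cong (_+ [ eqF a y ]) (deg-⊕-arc O x y a) ⟩
    deg O a + [ eqF a x ] + [ eqF a y ]   ≡⟨ cong (λ d → d + [ eqF a x ] + [ eqF a y ]) (balanced a) ⟩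
    indeg O a + [ eqF a x ] + [ eqF a y ] ≡⟨ xy∙z≈xz∙y (indeg O a) [ eqF a x ] [ eqF a y ] ⟩
    indeg O a + [ eqF a y ] + [ eqF a x ] ≡⟨ cong (_+ [ eqF a x ]) (indeg-⊕-arc O x y a) ⟨
    indeg (O ⊕ arc x y) a + [ eqF a x ]   ≡⟨ indeg-⊕-arc (O ⊕ arc x y) y x a ⟨
    indeg (O ⊕ arc x y ⊕ arc y x) a       ∎
    where open ≡-Reasoning

  orientation-cong : ∀ {M M′} → M ≐ M′ → EulerianOrientation M → EulerianOrientation M′
  orientation-cong M≐M′ (O , O≐M , balanced) =
    O , (λ a b → trans (O≐M a b) (M≐M′ a b)) , balanced

  reroute : ∀ M {x y} v (O : Mat n) → undirected O ≐ M ⊕ edge x y → Balanced O → 0 < O x y →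
            EulerianOrientation (M ⊕ edge x v ⊕ edge v y)
  reroute M {x} {y} v O O≐M balanced 0<Oxy = O′ ⊕ arc x v ⊕ arc v y , orients , balanced′
    where
    open ≡-Reasoning
    O′ : Mat n
    O′ = O ⊖ arc x y
    split : O ≐ O′ ⊕ arc x y
    split = ⊖-split (arc-≤ 0<Oxy)
    O′≐M : undirected O′ ≐ M
    O′≐M a b = +-cancelʳ-≡ (edge x y a b) _ _ (begin
      undirected O′ a b + edge x y a b ≡⟨ undirected-⊕-arc O′ x y a b ⟨
      undirected (O′ ⊕ arc x y) a b    ≡⟨ cong₂ _+_ (split a b) (split b a) ⟨
      undirected O a b                 ≡⟨ O≐M a b ⟩
      M a b + edge x y a b             ∎)
    orients : undirected (O′ ⊕ arc x v ⊕ arc v y) ≐ M ⊕ edge x v ⊕ edge v y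
    orients a b = begin
      undirected (O′ ⊕ arc x v ⊕ arc v y) a b
        ≡⟨ undirected-⊕-arc (O′ ⊕ arc x v) v y a b ⟩
      undirected (O′ ⊕ arc x v) a b + edge v y a b
        ≡⟨ cong (_+ edge v y a b) (undirected-⊕-arc O′ x v a b) ⟩
      undirected O′ a b + edge x v a b + edge v y a b
        ≡⟨ cong (λ m → m + edge x v a b + edge v y a b) (O′≐M a b) ⟩
      M a b + edge x v a b + edge v y a b
        ∎
    balanced′ : Balanced (O′ ⊕ arc x v ⊕ arc v y)
    balanced′ a = begin
      deg (O′ ⊕ arc x v ⊕ arc v y) a           ≡⟨ deg-⊕-arc (O′ ⊕ arc x v) v y a ⟩
      deg (O′ ⊕ arc x v) a + [ eqF a v ]       ≡⟨ cong (_+ [ eqF a v ]) (deg-⊕-arc O′ x v a) ⟩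
      deg O′ a + [ eqF a x ] + [ eqF a v ]     ≡⟨ cong (_+ [ eqF a v ]) (deg-⊕-arc O′ x y a) ⟨
      deg (O′ ⊕ arc x y) a + [ eqF a v ]       ≡⟨ cong (_+ [ eqF a v ]) (deg-cong split a) ⟨
      deg O a + [ eqF a v ]                    ≡⟨ cong (_+ [ eqF a v ]) (balanced a) ⟩
      indeg O a + [ eqF a v ]                  ≡⟨ cong (_+ [ eqF a v ]) (indeg-cong split a) ⟩
      indeg (O′ ⊕ arc x y) a + [ eqF a v ]     ≡⟨ cong (_+ [ eqF a v ]) (indeg-⊕-arc O′ x y a) ⟩
      indeg O′ a + [ eqF a y ] + [ eqF a v ]   ≡⟨ xy∙z≈xz∙y (indeg O′ a) [ eqF a y ] [ eqF a v ] ⟩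
      indeg O′ a + [ eqF a v ] + [ eqF a y ]   ≡⟨ cong (_+ [ eqF a y ]) (indeg-⊕-arc O′ x v a) ⟨
      indeg (O′ ⊕ arc x v) a + [ eqF a y ]     ≡⟨ indeg-⊕-arc (O′ ⊕ arc x v) v y a ⟨
      indeg (O′ ⊕ arc x v ⊕ arc v y) a         ∎

  remove-edge : ∀ {M x y} → Symmetric M → Loopless M → 0 < M x y → M ≐ (M ⊖ edge x y) ⊕ edge x y
  remove-edge symmetric loopless 0<Mxy = ⊖-split (edge-≤ symmetric (loopless-≢ loopless 0<Mxy) 0<Mxy)

  -- Splitting off at v: the edges vu, vw are replaced by uw (or just deleted if u = w); an
  -- orientation of the smaller multigraph yields one of M by routing the arc between u and w
  -- through v (or by adding the 2-cycle u → v → u).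
  record Wedge (M : Mat n) (v u w : Fin n) : Set where
    field
      rest      : Mat n
      split     : M ≐ rest ⊕ edge v u ⊕ edge v w
      symmetric : Symmetric rest
      loopless  : Loopless rest

  wedge : ∀ {M v u} → EvenMultigraph M → 0 < M v u → ∃ λ w → Wedge M v u w
  wedge {M} {v} {u} evenM 0<Mvu = w , record
    { rest      = M₁ ⊖ edge v w
    ; split     = split
    ; symmetric = ⊖-symmetric symmetric₁ (undirected-symmetric (arc v w))
    ; loopless  = ⊖-loopless M₁ (edge v w) loopless₁
    }
    where
    open EvenMultigraph evenM
    M₁ : Mat n
    M₁ = M ⊖ edge v u
    split₁ : M ≐ M₁ ⊕ edge v u
    split₁ = remove-edge symmetric loopless 0<Mvu
    symmetric₁ : Symmetric M₁
    symmetric₁ = ⊖-symmetric symmetric (undirected-symmetric (arc v u))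
    loopless₁ : Loopless M₁
    loopless₁ = ⊖-loopless M (edge v u) loopless
    deg-M : deg M v ≡ deg M₁ v + 1
    deg-M = begin
      deg M v                                 ≡⟨ deg-cong split₁ v ⟩
      deg (M₁ ⊕ edge v u) v                   ≡⟨ deg-⊕-edge M₁ v u v ⟩
      deg M₁ v + ([ eqF v v ] + [ eqF v u ])  ≡⟨ cong (λ b → deg M₁ v + ([ b ] + [ eqF v u ])) (eqF-refl v) ⟩
      deg M₁ v + suc [ eqF v u ]              ≡⟨ cong (λ b → deg M₁ v + suc [ b ]) (≢⇒eqF≡false v≢u) ⟩
      deg M₁ v + 1                            ∎
      where
      open ≡-Reasoning
      v≢u : v ≢ u
      v≢u = loopless-≢ loopless 0<Mvu
    0<deg-M₁ : 0 < deg M₁ v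
    0<deg-M₁ = n≢0⇒n>0 λ deg≡0 →
      contradiction (∣1⇒≡1 (subst (2 ∣_) (trans deg-M (cong (_+ 1) deg≡0)) (even v))) λ ()
    second-neighbour : ∃ λ w → 0 < M₁ v w
    second-neighbour = ∑-pos (M₁ v) 0<deg-M₁
    w : Fin n
    w = proj₁ second-neighbour
    split₂ : M₁ ≐ (M₁ ⊖ edge v w) ⊕ edge v w
    split₂ = remove-edge symmetric₁ loopless₁ (proj₂ second-neighbour)
    split : M ≐ (M₁ ⊖ edge v w) ⊕ edge v u ⊕ edge v w
    split a b = begin
      M a b                                               ≡⟨ split₁ a b ⟩
      M₁ a b + edge v u a b                               ≡⟨ cong (_+ edge v u a b) (split₂ a b) ⟩
      (M₁ ⊖ edge v w) a b + edge v w a b + edge v u a b   ≡⟨ xy∙z≈xz∙y ((M₁ ⊖ edge v w) a b) _ _ ⟩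
      (M₁ ⊖ edge v w) a b + edge v u a b + edge v w a b   ∎
      where open ≡-Reasoning

  module _ {M v u w} (W : Wedge M v u w) where
    open Wedge W

    deg-wedge : ∀ a → deg M a ≡ deg rest a + ([ eqF a v ] + [ eqF a u ]) + ([ eqF a v ] + [ eqF a w ])
    deg-wedge a = begin
      deg M a
        ≡⟨ deg-cong split a ⟩
      deg (rest ⊕ edge v u ⊕ edge v w) a
        ≡⟨ deg-⊕-edge (rest ⊕ edge v u) v w a ⟩
      deg (rest ⊕ edge v u) a + ([ eqF a v ] + [ eqF a w ])
        ≡⟨ cong (_+ ([ eqF a v ] + [ eqF a w ])) (deg-⊕-edge rest v u a) ⟩
      deg rest a + ([ eqF a v ] + [ eqF a u ]) + ([ eqF a v ] + [ eqF a w ])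
        ∎
      where open ≡-Reasoning

    total-wedge : total M ≡ total rest + 2 + 2
    total-wedge = begin
      total M                                ≡⟨ total-cong split ⟩
      total (rest ⊕ edge v u ⊕ edge v w)     ≡⟨ total-⊕-edge (rest ⊕ edge v u) v w ⟩
      total (rest ⊕ edge v u) + 2            ≡⟨ cong (_+ 2) (total-⊕-edge rest v u) ⟩
      total rest + 2 + 2                     ∎
      where open ≡-Reasoning

    rest-smaller : total rest < total M
    rest-smaller = subst (total rest <_) (sym total-wedge) (≤-trans (m<m+n (total rest) z<s) (m≤m+n _ 2))

    splitOff-smaller : total (rest ⊕ edge u w) < total M
    splitOff-smaller = subst₂ _<_ (sym (total-⊕-edge rest u w)) (sym total-wedge) (m<m+n (total rest + 2) z<s)

    rest-even : u ≡ w → EvenMultigraph M → EvenMultigraph rest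
    rest-even refl evenM = record
      { symmetric = symmetric
      ; loopless  = loopless
      ; even      = λ a → 2∣-cancel ([ eqF a v ] + [ eqF a u ]) (deg-M a) (EvenMultigraph.even evenM a)
      }
      where
      deg-M : ∀ a → deg M a ≡ deg rest a + (([ eqF a v ] + [ eqF a u ]) + ([ eqF a v ] + [ eqF a u ]))
      deg-M a = trans (deg-wedge a) (+-assoc (deg rest a) ([ eqF a v ] + [ eqF a u ]) _)

    splitOff-even : u ≢ w → EvenMultigraph M → EvenMultigraph (rest ⊕ edge u w)
    splitOff-even u≢w evenM = record
      { symmetric = λ a b → cong₂ _+_ (symmetric a b) (undirected-symmetric (arc u w) a b)
      ; loopless  = λ a → cong₂ _+_ (loopless a) (edge-loopless u≢w a)
      ; even      = λ a → 2∣-cancel [ eqF a v ] (deg-M a) (EvenMultigraph.even evenM a)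
      }
      where
      regroup : ∀ r p q s → r + (p + q) + (p + s) ≡ r + (q + s) + (p + p)
      regroup = solve-∀
      deg-M : ∀ a → deg M a ≡ deg (rest ⊕ edge u w) a + ([ eqF a v ] + [ eqF a v ])
      deg-M a = trans (deg-wedge a) (trans (regroup (deg rest a) [ eqF a v ] [ eqF a u ] [ eqF a w ])
        (cong (_+ ([ eqF a v ] + [ eqF a v ])) (sym (deg-⊕-edge rest u w a))))

    orient-from-rest : u ≡ w → EulerianOrientation rest → EulerianOrientation M
    orient-from-rest refl (O , O≐rest , balanced) =
      O ⊕ arc v u ⊕ arc u v , orients , balanced-⊕-2cycle v u balanced
      where
      open ≡-Reasoning
      orients : undirected (O ⊕ arc v u ⊕ arc u v) ≐ M
      orients a b = begin
        undirected (O ⊕ arc v u ⊕ arc u v) a b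
          ≡⟨ undirected-⊕-arc (O ⊕ arc v u) u v a b ⟩
        undirected (O ⊕ arc v u) a b + edge u v a b
          ≡⟨ cong (_+ edge u v a b) (undirected-⊕-arc O v u a b) ⟩
        undirected O a b + edge v u a b + edge u v a b
          ≡⟨ cong₂ (λ r e → r + edge v u a b + e) (O≐rest a b) (edge-comm u v a b) ⟩
        rest a b + edge v u a b + edge v u a b
          ≡⟨ split a b ⟨
        M a b
          ∎

    orient-from-splitOff : u ≢ w → EulerianOrientation (rest ⊕ edge u w) → EulerianOrientation M
    orient-from-splitOff u≢w (O , O≐ , balanced) with 0 <? O u w
    ... | yes 0<Ouw = orientation-cong via-u→w (reroute rest v O O≐ balanced 0<Ouw)
      where
      via-u→w : rest ⊕ edge u v ⊕ edge v w ≐ M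
      via-u→w a b = trans (cong (λ e → rest a b + e + edge v w a b) (edge-comm u v a b)) (sym (split a b))
    ... | no  ¬0<Ouw = orientation-cong via-w→u (reroute rest v O O≐′ balanced 0<Owu)
      where
      O≐′ : undirected O ≐ rest ⊕ edge w u
      O≐′ a b = trans (O≐ a b) (cong (rest a b +_) (edge-comm u w a b))
      via-w→u : rest ⊕ edge w v ⊕ edge v u ≐ M
      via-w→u a b = trans (cong (λ e → rest a b + e + edge v u a b) (edge-comm w v a b))
        (trans (xy∙z≈xz∙y (rest a b) (edge v w a b) (edge v u a b)) (sym (split a b)))
      0<Owu : 0 < O w u
      0<Owu = subst (0 <_) (cong (_+ O w u) (n≤0⇒n≡0 (≮⇒≥ ¬0<Ouw))) (begin-strict
        0                       <⟨ s≤s z≤n ⟩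
        1                       ≤⟨ m≤n+m 1 (rest u w) ⟩
        rest u w + 1            ≡⟨ cong (rest u w +_) (edge-at u w u≢w) ⟨
        rest u w + edge u w u w ≡⟨ O≐ u w ⟨
        O u w + O w u           ∎)
        where open ≤-Reasoning

  eulerianOrientation : ∀ M → EvenMultigraph M → EulerianOrientation M
  eulerianOrientation =
    All.wfRec (On.wellFounded total <-wellFounded) _ (λ M → EvenMultigraph M → EulerianOrientation M) step
    where
    step : ∀ M → (∀ {M′} → total M′ < total M → EvenMultigraph M′ → EulerianOrientation M′) →
           EvenMultigraph M → EulerianOrientation M
    step M below evenM with any? (λ v → any? λ u → 0 <? M v u)
    ... | no  noEdge = (λ _ _ → 0) , (λ a b → sym (n≤0⇒n≡0 (≮⇒≥ (noEdge ∘ (a ,_) ∘ (b ,_))))) , (λ _ → refl)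
    ... | yes (v , u , 0<Mvu) with w , W ← wedge evenM 0<Mvu | u ≟ w
    ...   | yes u≡w = orient-from-rest W u≡w (below (rest-smaller W) (rest-even W u≡w evenM))
    ...   | no  u≢w = orient-from-splitOff W u≢w (below (splitOff-smaller W) (splitOff-even W u≢w evenM))

-- 2-factors and the line graph

module _ {n : ℕ} (G : Graph (Fin n)) where

  -- A 2-factor, given by a cyclic orientation of its cycles (all of length at least 3).
  record TwoFactor : Set where
    field
      next           : Fin n → Fin n
      next-injective : Injective _≡_ _≡_ next
      adjacent       : ∀ x → T (Adj G x (next x))
      no-2-cycle     : ∀ x → next (next x) ≢ x

  adjacency : Mat n
  adjacency a b = [ Adj G a b ]

  adjacency-even : ∀ k → Regular G (k + k) → EvenMultigraph adjacency
  adjacency-even k regular = record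
    { symmetric = λ a b → cong [_] (Graph.sym G a b)
    ; loopless  = λ a → cong [_] (Graph.irrefl G a)
    ; even      = λ a → subst (2 ∣_) (sym (deg-adjacency a)) (2∣n+n k)
    }
    where
    deg-adjacency : ∀ a → deg adjacency a ≡ k + k
    deg-adjacency a = trans (sym (countTrue-map-allFin n (Adj G a))) (regular a)

  module _ (O : Mat n) (O≐adjacency : undirected O ≐ adjacency) where

    O≤[Adj] : ∀ a b → O a b ≤ [ Adj G a b ]
    O≤[Adj] a b = ≤-trans (m≤m+n (O a b) (O b a)) (≤-reflexive (O≐adjacency a b))

    arc⇒Adj : ∀ {a b} → 0 < O a b → T (Adj G a b)
    arc⇒Adj {a} {b} 0<Oab = 0<[]⇒T (<-≤-trans 0<Oab (O≤[Adj] a b))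

    ¬2-cycle : ∀ {a b} → 0 < O a b → 0 < O b a → ⊥
    ¬2-cycle {a} {b} 0<Oab 0<Oba = contradiction (begin
      2                     ≤⟨ +-mono-≤ 0<Oab 0<Oba ⟩
      O a b + O b a         ≡⟨ O≐adjacency a b ⟩
      [ Adj G a b ]         ≤⟨ []≤1 (Adj G a b) ⟩
      1                     ∎) λ { (s≤s ()) }
      where open ≤-Reasoning

    [0<ᵇO]≡O : ∀ a b → [ 0 <ᵇ O a b ] ≡ O a b
    [0<ᵇO]≡O a b = [0<ᵇn]≡n (O a b) (≤-trans (O≤[Adj] a b) ([]≤1 (Adj G a b)))

    balanced⇒deg≡ : ∀ k → Regular G (k + k) → Balanced O → ∀ a → deg O a ≡ k
    balanced⇒deg≡ k regular balanced a = m+m≡n+n⇒m≡n (deg O a) k (begin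
      deg O a + deg O a    ≡⟨ cong (deg O a +_) (balanced a) ⟩
      deg O a + indeg O a  ≡⟨ deg-undirected O a ⟨
      deg (undirected O) a ≡⟨ deg-cong O≐adjacency a ⟩
      deg adjacency a      ≡⟨ countTrue-map-allFin n (Adj G a) ⟨
      degree G a           ≡⟨ regular a ⟩
      k + k                ∎)
      where open ≡-Reasoning

  petersen : ∀ k → 0 < k → Regular G (k + k) → TwoFactor
  petersen k@(suc _) _ regular
    with O , O≐adjacency , balanced ← eulerianOrientation adjacency (adjacency-even k regular)
    = twoFactor (hall B (biregular-hallCondition k (≤-reflexive ∘ sym ∘ outdeg≡k) (≤-reflexive ∘ indeg≡k)))
    where
    B : Fin n → Fin n → Bool
    B x c = 0 <ᵇ O x c
    deg≡k : ∀ a → deg O a ≡ k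
    deg≡k = balanced⇒deg≡ O O≐adjacency k regular balanced
    outdeg≡k : ∀ x → ∑[ c < n ] [ B x c ] ≡ k
    outdeg≡k x = trans (sum-cong-≗ ([0<ᵇO]≡O O O≐adjacency x)) (deg≡k x)
    indeg≡k : ∀ c → ∑[ x < n ] [ B x c ] ≡ k
    indeg≡k c = trans (sum-cong-≗ λ x → [0<ᵇO]≡O O O≐adjacency x c) (trans (sym (balanced c)) (deg≡k c))
    twoFactor : Matching B → TwoFactor
    twoFactor (σ , σ-injective , σ-arc) = record
      { next           = σ
      ; next-injective = σ-injective
      ; adjacent       = λ x → arc⇒Adj O O≐adjacency (0<O x)
      ; no-2-cycle     = λ x σσx≡x →
          ¬2-cycle O O≐adjacency (0<O x) (subst (λ y → 0 < O (σ x) y) σσx≡x (0<O (σ x)))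
      }
      where
      0<O : ∀ x → 0 < O x (σ x)
      0<O x = <ᵇ⇒< 0 (O x (σ x)) (σ-arc x)

  Endpoint : Fin n → Edge G → Set
  Endpoint z ((a , b) , _) = z ≡ a ⊎ z ≡ b

  ¬Adj-toℕ≡ : ∀ {x y} → toℕ x ≡ toℕ y → ¬ T (Adj G x y)
  ¬Adj-toℕ≡ {x} x≡y with refl ← Finₚ.toℕ-injective x≡y = subst T (Graph.irrefl G x)

  mkEdge : ∀ x y → T (Adj G x y) → Edge G
  mkEdge x y xy with <-cmp (toℕ x) (toℕ y)
  ... | tri< x<y _ _ = (x , y) , x<y , xy
  ... | tri≈ _ x≡y _ = ⊥-elim (¬Adj-toℕ≡ x≡y xy)
  ... | tri> _ _ y<x = (y , x) , y<x , subst T (Graph.sym G x y) xy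

  Endpoint-mkEdge : ∀ {x y} (xy : T (Adj G x y)) z → Endpoint z (mkEdge x y xy) ⇔ (z ≡ x ⊎ z ≡ y)
  Endpoint-mkEdge {x} {y} xy z with <-cmp (toℕ x) (toℕ y)
  ... | tri< _ _ _   = mk⇔ (λ z∈ → z∈) (λ z∈ → z∈)
  ... | tri≈ _ x≡y _ = ⊥-elim (¬Adj-toℕ≡ x≡y xy)
  ... | tri> _ _ _   = mk⇔ Sum.swap Sum.swap

  ¬lineAdj-self : ∀ e → ¬ T (lineAdj G e e)
  ¬lineAdj-self e = subst T (lineAdj-irrefl G e)

  shared-endpoint : ∀ e f → T (lineAdj G e f) → ∃ λ z → Endpoint z e × Endpoint z f
  shared-endpoint ((a , b) , _) ((c , d) , _) e~f
    with to (T-∨ {eqF a c}) (proj₂ (to (T-∧ {not (eqF a c ∧ eqF b d)}) e~f))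
  ... | inj₁ a=c = a , inj₁ refl , inj₁ (eqF⇒≡ a=c)
  ... | inj₂ rest with to (T-∨ {eqF a d}) rest
  ...   | inj₁ a=d = a , inj₁ refl , inj₂ (eqF⇒≡ a=d)
  ...   | inj₂ rest′ with to (T-∨ {eqF b c}) rest′
  ...     | inj₁ b=c = b , inj₂ refl , inj₁ (eqF⇒≡ b=c)
  ...     | inj₂ b=d = b , inj₂ refl , inj₂ (eqF⇒≡ b=d)

  module _ (F : TwoFactor) where
    open TwoFactor F

    cycleEdge : Fin n → Edge G
    cycleEdge x = mkEdge x (next x) (adjacent x)

    cycleEdges : List (Edge G)
    cycleEdges = map cycleEdge (allFin n)

    Endpoint-cycleEdge : ∀ x z → Endpoint z (cycleEdge x) ⇔ (z ≡ x ⊎ z ≡ next x)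
    Endpoint-cycleEdge x = Endpoint-mkEdge (adjacent x)

    cycleEdge-≡⇒endpoints : ∀ {x y} → cycleEdge x ≡ cycleEdge y →
                            ∀ z → z ≡ x ⊎ z ≡ next x → z ≡ y ⊎ z ≡ next y
    cycleEdge-≡⇒endpoints {x} {y} eq z =
      to (Endpoint-cycleEdge y z) ∘ subst (Endpoint z) eq ∘ from (Endpoint-cycleEdge x z)

    cycleEdge-injective : Injective _≡_ _≡_ cycleEdge
    cycleEdge-injective {x} {y} eq
      with cycleEdge-≡⇒endpoints eq x (inj₁ refl) | cycleEdge-≡⇒endpoints eq (next x) (inj₂ refl)
    ... | inj₁ x≡y  | _                  = x≡y
    ... | inj₂ _    | inj₂ next-x≡next-y = next-injective next-x≡next-y
    ... | inj₂ refl | inj₁ next-x≡y      = contradiction next-x≡y (no-2-cycle y)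

    cycleEdges-unique : Unique cycleEdges
    cycleEdges-unique = Uniqueₚ.map⁺ cycleEdge-injective (Uniqueₚ.allFin⁺ n)

    length-cycleEdges : length cycleEdges ≡ n
    length-cycleEdges = trans (length-map cycleEdge (allFin n)) (length-tabulate (λ i → i))

    cycleEdge-neighbours : ∀ v u → T (lineAdj G (cycleEdge v) (cycleEdge u)) → u ≡ next v ⊎ next u ≡ v
    cycleEdge-neighbours v u v~u
      with z , z∈v , z∈u ← shared-endpoint (cycleEdge v) (cycleEdge u) v~u
      with to (Endpoint-cycleEdge v z) z∈v | to (Endpoint-cycleEdge u z) z∈u
    ... | inj₁ refl | inj₁ refl          = ⊥-elim (¬lineAdj-self (cycleEdge v) v~u)
    ... | inj₁ refl | inj₂ z≡next-u      = inj₂ (sym z≡next-u)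
    ... | inj₂ refl | inj₁ refl          = inj₁ refl
    ... | inj₂ refl | inj₂ next-v≡next-u with refl ← next-injective next-v≡next-u =
      ⊥-elim (¬lineAdj-self (cycleEdge v) v~u)

    degIn-cycleEdges : ∀ v → degIn (LineGraph G) cycleEdges (cycleEdge v) ≤ 2
    degIn-cycleEdges v = begin
      countTrue (map (lineAdj G (cycleEdge v)) (map cycleEdge (allFin n)))
        ≡⟨ cong countTrue (map-∘ (allFin n)) ⟨
      countTrue (map (lineAdj G (cycleEdge v) ∘ cycleEdge) (allFin n))
        ≡⟨ countTrue-map-allFin n _ ⟩
      ∑[ u < n ] [ lineAdj G (cycleEdge v) (cycleEdge u) ]
        ≤⟨ ∑-mono-≤ {n} (λ u → []≤[]+[] (Sum.map ≡⇒eqF ≡⇒eqF ∘ cycleEdge-neighbours v u)) ⟩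
      ∑[ u < n ] ([ eqF u (next v) ] + [ eqF (next u) v ])
        ≡⟨ ∑-distrib-+ (λ u → [ eqF u (next v) ]) (λ u → [ eqF (next u) v ]) ⟩
      ∑[ u < n ] [ eqF u (next v) ] + ∑[ u < n ] [ eqF (next u) v ]
        ≤⟨ +-mono-≤ (≤-reflexive (∑-δ (next v))) (∑-atMostOne (λ u → eqF (next u) v) λ u↦v u′↦v →
             next-injective (trans (eqF⇒≡ u↦v) (sym (eqF⇒≡ u′↦v)))) ⟩
      2 ∎
      where open ≤-Reasoning

    cycleEdges-2-independent : IsPIndependent (LineGraph G) 2 cycleEdges
    cycleEdges-2-independent = cycleEdges-unique , λ e e∈ → case ∈-map⁻ cycleEdge e∈ of λ where
      (v , _ , refl) → degIn-cycleEdges v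

IsPIndependent-mono : ∀ {V : Set} (G : Graph V) {p q S} →
                      p ≤ q → IsPIndependent G p S → IsPIndependent G q S
IsPIndependent-mono G p≤q (unique , bounded) = unique , λ v v∈S → ≤-trans (bounded v v∈S) p≤q

theorem8 : (n r : ℕ) (G : Graph (Fin n)) →
    Regular G r → Σ ℕ (λ k → r ≡ k + k) → 2 ≤ r →
    (p q : ℕ) → 2 ≤ q →
    AlphaLe G p (LineGraph G) q
theorem8 n r G regular (k , r≡k+k) 2≤r p q 2≤q S (S-unique , _) =
    cycleEdges G F
  , IsPIndependent-mono (LineGraph G) 2≤q (cycleEdges-2-independent G F)
  , ≤-trans (Unique⇒length≤ S S-unique) (≤-reflexive (sym (length-cycleEdges G F)))
  where
  0<k : 0 < k
  0<k = n≢0⇒n>0 λ { refl → contradiction (subst (2 ≤_) r≡k+k 2≤r) λ () }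
  F : TwoFactor G
  F = petersen G k 0<k (λ v → trans (regular v) r≡k+k)
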